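{- Let $X$ be a finite set of variables, $\preceq$ a monomial ordering, and $Q \subseteq \mathbb{Q}[X]$ a finite set of polynomials. Consider the procedure $\mathsf{saturate}(Q)$: initialize $Z := \emptyset$ and $P := Q \cup \{1\}$; while there exists a non-zero $t \in \mathrm{units}(\mathrm{cone}(P))$, choose any such $t$, let $G$ be a Gröbner basis of the ideal generated by $Z \cup \{t\}$ with respect to $\preceq$, and set $Z := G$ and $P := \{\mathbf{red}_G(p) : p \in P,\ \mathbf{red}_G(p) \neq 0\}$; when no such $t$ exists, return $\langle Z,P\rangle$. Then this procedure terminates, and the pair $\langle Z,P\rangle$ it returns satisfies that $\mathrm{alg.cone}(Z,P)$ is the least regular cone in $\mathbb{Q}[X]$ that contains $Q$.
   Context: A cone in $\mathbb{Q}[X]$ is a subset containing $0$ closed under addition and multiplication by non-negative rationals; $\mathrm{cone}(P)$ is the set of non-negative rational combinations of elements of $P$. For a cone $C$, $\mathrm{units}(C) = \{p : p \in C, -p\in C\}$. A regular cone is a cone $C$ with $1 \in C$ such that $\mathrm{units}(C)$ is an ideal of $\mathbb{Q}[X]$. $\mathrm{alg.cone}(Z,P) = \langle Z\rangle + \mathrm{cone}(P)$, where $\langle Z\rangle$ is the ideal generated by $Z$. $\mathbf{red}_G(p)$ denotes the normal form of $p$ modulo the Gröbner basis $G$. -}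

module Defs where

open import Data.Nat as ℕ using (ℕ)
open import Data.Rational as ℚ using (ℚ; 0ℚ; 1ℚ)
open import Data.Product using (Σ; ∃; ∃₂; _×_; _,_)
open import Data.List using (List; []; _∷_; _++_; map; foldr; concatMap)
open import Data.List.Relation.Unary.All using (All)
open import Data.List.Relation.Unary.Any using (Any)
open import Data.List.Membership.Propositional using (_∈_)
open import Data.Vec as Vec using (Vec)
open import Data.Vec.Properties using (≡-dec)
open import Relation.Nullary using (¬_; yes; no)
open import Relation.Binary using (IsTotalOrder)
open import Relation.Binary.PropositionalEquality using (_≡_; _≢_)
open import Induction.WellFounded using (WellFounded)

Mon : ℕ → Set
Mon n = Vec ℕ n

_·ₘ_ : ∀ {n} → Mon n → Mon n → Mon n
a ·ₘ b = Vec.zipWith ℕ._+_ a b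

oneₘ : ∀ {n} → Mon n
oneₘ = Vec.replicate _ 0

_∣ₘ_ : ∀ {n} → Mon n → Mon n → Set
a ∣ₘ b = ∃ λ c → a ·ₘ c ≡ b

record MonomialOrder (n : ℕ) : Set₁ where
  field
    _≼_         : Mon n → Mon n → Set
    isTotalOrder : IsTotalOrder _≡_ _≼_
    multiplicative : ∀ a b c → a ≼ b → (a ·ₘ c) ≼ (b ·ₘ c)
    wellOrdered : WellFounded (λ a b → a ≼ b × a ≢ b)

-- Polynomials in ℚ[X], X = Fin n, as formal finite sums of terms
-- (coefficient, monomial); equality is equality of all coefficients.

Poly : ℕ → Set
Poly n = List (ℚ × Mon n)

coeff : ∀ {n} → Poly n → Mon n → ℚ
coeff [] m = 0ℚ
coeff ((c , m') ∷ p) m with ≡-dec ℕ._≟_ m' m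
... | yes _ = c ℚ.+ coeff p m
... | no  _ = coeff p m

infix 4 _≈_
_≈_ : ∀ {n} → Poly n → Poly n → Set
p ≈ q = ∀ m → coeff p m ≡ coeff q m

0ₚ : ∀ {n} → Poly n
0ₚ = []

1ₚ : ∀ {n} → Poly n
1ₚ = (1ℚ , oneₘ) ∷ []

_+ₚ_ : ∀ {n} → Poly n → Poly n → Poly n
p +ₚ q = p ++ q

_·ₚ_ : ∀ {n} → ℚ → Poly n → Poly n
c ·ₚ p = map (λ { (a , m) → (c ℚ.* a , m) }) p

-ₚ_ : ∀ {n} → Poly n → Poly n
-ₚ p = map (λ { (a , m) → (ℚ.- a , m) }) p

_-ₚ_ : ∀ {n} → Poly n → Poly n → Poly n
p -ₚ q = p +ₚ (-ₚ q)

_*ₚ_ : ∀ {n} → Poly n → Poly n → Poly n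
p *ₚ q = concatMap (λ { (a , m) → map (λ { (b , m') → (a ℚ.* b , m ·ₘ m') }) q }) p

sumₚ : ∀ {n} → List (Poly n) → Poly n
sumₚ = foldr _+ₚ_ 0ₚ

PSet : ℕ → Set₁
PSet n = Poly n → Set

Respects≈ : ∀ {n} → PSet n → Set
Respects≈ S = ∀ p q → p ≈ q → S p → S q

IsCone : ∀ {n} → PSet n → Set
IsCone C = Respects≈ C × C 0ₚ
         × (∀ p q → C p → C q → C (p +ₚ q))
         × (∀ c p → 0ℚ ℚ.≤ c → C p → C (c ·ₚ p))

IsIdeal : ∀ {n} → PSet n → Set
IsIdeal I = Respects≈ I × I 0ₚ
          × (∀ p q → I p → I q → I (p +ₚ q))
          × (∀ r p → I p → I (r *ₚ p))

units : ∀ {n} → PSet n → PSet n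
units C p = C p × C (-ₚ p)

IsRegularCone : ∀ {n} → PSet n → Set
IsRegularCone C = IsCone C × C 1ₚ × IsIdeal (units C)

cone : ∀ {n} → List (Poly n) → PSet n
cone P p = ∃ λ (ls : List (ℚ × Poly _)) →
  All (λ { (c , q) → 0ℚ ℚ.≤ c × q ∈ P }) ls
  × p ≈ sumₚ (map (λ { (c , q) → c ·ₚ q }) ls)

ideal : ∀ {n} → List (Poly n) → PSet n
ideal Z p = ∃ λ (ls : List (Poly _ × Poly _)) →
  All (λ { (r , z) → z ∈ Z }) ls
  × p ≈ sumₚ (map (λ { (r , z) → r *ₚ z }) ls)

algCone : ∀ {n} → List (Poly n) → List (Poly n) → PSet n
algCone Z P p = ∃₂ λ a b → ideal Z a × cone P b × p ≈ a +ₚ b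

module _ {n : ℕ} (ord : MonomialOrder n) where
  open MonomialOrder ord

  IsLM : Poly n → Mon n → Set
  IsLM f m = coeff f m ≢ 0ℚ × (∀ m' → coeff f m' ≢ 0ℚ → m' ≼ m)

  IsGroebnerBasis : PSet n → List (Poly n) → Set
  IsGroebnerBasis I G =
    All I G ×
    (∀ f → I f → ∀ m → IsLM f m →
       Any (λ g → ∃ λ mg → IsLM g mg × mg ∣ₘ m) G)

  IsNormalForm : List (Poly n) → Poly n → Poly n → Set
  IsNormalForm G p r =
    ideal G (p -ₚ r) ×
    (∀ m → coeff r m ≢ 0ℚ → All (λ g → ∀ mg → IsLM g mg → ¬ (mg ∣ₘ m)) G)

  data Reduced (G : List (Poly n)) : List (Poly n) → List (Poly n) → Set where
    []    : Reduced G [] []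
    drop  : ∀ {p r P P'} → IsNormalForm G p r → r ≈ 0ₚ →
            Reduced G P P' → Reduced G (p ∷ P) P'
    keep  : ∀ {p r P P'} → IsNormalForm G p r → ¬ (r ≈ 0ₚ) →
            Reduced G P P' → Reduced G (p ∷ P) (r ∷ P')

  State : Set
  State = List (Poly n) × List (Poly n)

  NonZeroUnit : List (Poly n) → Poly n → Set
  NonZeroUnit P t = units (cone P) t × ¬ (t ≈ 0ₚ)

  data Step : State → State → Set where
    step : ∀ {Z P G P'} t → NonZeroUnit P t →
           IsGroebnerBasis (ideal (t ∷ Z)) G →
           Reduced G P P' →
           Step (Z , P) (G , P')

  Final : State → Set
  Final (Z , P) = ¬ (∃ λ t → NonZeroUnit P t)

initState : ∀ {n} → List (Poly n) → List (Poly n) × List (Poly n)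
initState Q = ([] , 1ₚ ∷ Q)

IsLeastRegularConeContaining : ∀ {n} → PSet n → List (Poly n) → Set₁
IsLeastRegularConeContaining {n} S Q =
  IsRegularCone S × All S Q ×
  (∀ (C : PSet n) → IsRegularCone C → All C Q → ∀ p → S p → C p)

{-# OPTIONS --safe #-}
module Submission where

-- Each iteration picks t ≠ 0 in cone(P), where every element of P is reduced modulo the Gröbner
-- basis Z; so LM(t) is divisible by no leading monomial of Z, whereas the new basis has leading
-- monomials dividing LM(t) and all those of Z. The successive LM(t) thus form a bad sequence for
-- divisibility, which is finite by Dickson's lemma.
-- Throughout the loop Z is a Gröbner basis, P is reduced modulo Z, and alg.cone(Z,P) never shrinks
-- since p − red_G(p) ∈ ⟨G⟩. Once cone(P) has no non-zero unit, units(alg.cone(Z,P)) = ⟨Z⟩, so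
-- alg.cone(Z,P) is regular. Conversely a regular cone C ⊇ Q contains each chosen t as a unit, hence
-- ⟨Z⟩ ⊆ units(C) and P ⊆ C at every stage, and so alg.cone(Z,P) ⊆ C.

open import Defs renaming
  ( _+ₚ_ to infixl 6 _+ₚ_; _-ₚ_ to infixl 6 _-ₚ_; _*ₚ_ to infixl 7 _*ₚ_; _·ₚ_ to infixr 7 _·ₚ_
  ; -ₚ_ to infix 8 -ₚ_; _·ₘ_ to infixl 7 _·ₘ_ )
open import Data.Empty using (⊥-elim)
open import Data.Fin as Fin using (Fin; punchOut)
open import Data.Fin.Properties using (¬∀⟶∃¬)
open import Data.List using (List; []; _∷_; _++_; map; concatMap; filter; upTo; allFin; length)
import Data.List.Properties as List
open import Data.List.Membership.Propositional using (_∈_; find)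
open import Data.List.Membership.Propositional.Properties using (∈-upTo⁺; ∈-allFin; ∈-map⁺; ∈-concatMap⁺; ∈-filter⁺)
open import Data.List.Relation.Binary.Subset.Propositional using (_⊆_)
open import Data.List.Relation.Unary.All as All using (All; []; _∷_)
open import Data.List.Relation.Unary.All.Properties using (++⁺; map⁺; all-filter; All¬⇒¬Any)
open import Data.List.Relation.Unary.Any as Any using (Any; here; there)
open import Data.Nat as ℕ using (ℕ; zero; suc; _≤_; _<_)
import Data.Nat.Properties as ℕP
open import Data.Product using (∃; _×_; _,_; proj₁; proj₂)
open import Data.Rational as ℚ using (ℚ; 0ℚ; 1ℚ)
import Data.Rational.Properties as ℚP
open import Data.Rational.Solver using (module +-*-Solver)
open import Data.Sum using (_⊎_; inj₁; inj₂)
open import Data.Vec as Vec using (Vec; lookup; removeAt)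
open import Data.Vec.Membership.Propositional.Properties using (∈-fromList⁺)
open import Data.Vec.Properties using (≡-dec; removeAt-punchOut; zipWith-comm; zipWith-assoc; zipWith-identityˡ)
open import Data.Vec.Relation.Binary.Lex.Core using (this; next)
open import Data.Vec.Relation.Binary.Lex.Strict using (Lex-<; <-wellFounded)
import Data.Vec.Relation.Unary.Any as VecAny
open import Function using (id; _∘_; case_of_)
open import Induction.WellFounded using (Acc; acc; WellFounded)
open import Level using (0ℓ)
open import Relation.Binary using (Rel; Setoid; IsEquivalence; TotalOrder)
open import Relation.Binary.Construct.Closure.ReflexiveTransitive using (Star; ε; _◅_)
open import Relation.Binary.PropositionalEquality
open import Relation.Nullary using (Dec; yes; no; ¬_; ¬?; contradiction)
open import Relation.Nullary.Decidable using (decidable-stable)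
open import Relation.Unary using (_⊆′_; _≐′_)
import Relation.Binary.Reasoning.Setoid
open import Algebra.Properties.Group ℚP.+-0-group using (inverseʳ-unique)

-- Dickson's lemma

_≤ᵥ_ : ∀ {n} → Rel (Vec ℕ n) 0ℓ
x ≤ᵥ y = ∀ i → lookup x i ≤ lookup y i

-- Bad sequences are stored newest first.
BadExtension : ∀ {n} → Rel (List (Vec ℕ n)) 0ℓ
BadExtension L′ L = ∃ λ y → L′ ≡ y ∷ L × All (λ z → ¬ z ≤ᵥ y) L

module _ {A K : Set} {_≺_ : Rel A 0ℓ} (f g : K → A) (f≼g : ∀ k → f k ≡ g k ⊎ f k ≺ g k) where

  map-Lex-< : ∀ {m} {ks : Vec K m} → VecAny.Any (λ k → f k ≺ g k) ks →
              Lex-< _≡_ _≺_ (Vec.map f ks) (Vec.map g ks)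
  map-Lex-< {ks = k Vec.∷ ks} (VecAny.here fk≺gk) = this fk≺gk refl
  map-Lex-< {ks = k Vec.∷ ks} (VecAny.there any) with f≼g k
  ... | inj₁ fk≡gk = next fk≡gk (map-Lex-< any)
  ... | inj₂ fk≺gk = this fk≺gk refl

module _ {n : ℕ} where

  slice : Fin (suc n) → ℕ → List (Vec ℕ (suc n)) → List (Vec ℕ n)
  slice i v [] = []
  slice i v (z ∷ L) with lookup z i ℕ.≟ v
  ... | yes _ = removeAt z i ∷ slice i v L
  ... | no  _ = slice i v L

  ≤ᵥ-removeAt : ∀ i (z y : Vec ℕ (suc n)) → lookup z i ≡ lookup y i →
                removeAt z i ≤ᵥ removeAt y i → z ≤ᵥ y
  ≤ᵥ-removeAt i z y zᵢ≡yᵢ z≤y j with i Fin.≟ j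
  ... | yes refl = ℕP.≤-reflexive zᵢ≡yᵢ
  ... | no i≢j = subst₂ _≤_ (removeAt-punchOut z i≢j) (removeAt-punchOut y i≢j) (z≤y (punchOut i≢j))

  slice-bad : ∀ i (y : Vec ℕ (suc n)) {L} → All (λ z → ¬ z ≤ᵥ y) L →
              All (λ w → ¬ w ≤ᵥ removeAt y i) (slice i (lookup y i) L)
  slice-bad i y [] = []
  slice-bad i y {z ∷ L} (z≰y ∷ bad) with lookup z i ℕ.≟ lookup y i
  ... | yes zᵢ≡yᵢ = (λ w≤y → z≰y (≤ᵥ-removeAt i z y zᵢ≡yᵢ w≤y)) ∷ slice-bad i y bad
  ... | no  _ = slice-bad i y bad

  slice-∷ : ∀ i v (y : Vec ℕ (suc n)) L → All (λ z → ¬ z ≤ᵥ y) L →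
            slice i v (y ∷ L) ≡ slice i v L ⊎ BadExtension (slice i v (y ∷ L)) (slice i v L)
  slice-∷ i v y L bad with lookup y i ℕ.≟ v
  ... | yes refl = inj₂ (removeAt y i , refl , slice-bad i y bad)
  ... | no  _ = inj₁ refl

  slice-∷-own : ∀ i (y : Vec ℕ (suc n)) L → All (λ z → ¬ z ≤ᵥ y) L →
                BadExtension (slice i (lookup y i) (y ∷ L)) (slice i (lookup y i) L)
  slice-∷-own i y L bad with lookup y i ℕ.≟ lookup y i
  ... | yes _ = removeAt y i , refl , slice-bad i y bad
  ... | no yᵢ≢yᵢ = contradiction refl yᵢ≢yᵢ

  -- Once x is in the list, every later element y has some yᵢ < xᵢ; the finitely
  -- many slices {z : zᵢ = v} with v < xᵢ then decrease lexicographically.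
  module _ (x : Vec ℕ (suc n)) where

    keys : List (Fin (suc n) × ℕ)
    keys = concatMap (λ i → map (i ,_) (upTo (lookup x i))) (allFin (suc n))

    slices : List (Vec ℕ (suc n)) → Vec (List (Vec ℕ n)) (length keys)
    slices L = Vec.map (λ k → slice (proj₁ k) (proj₂ k) L) (Vec.fromList keys)

    slices-decrease : ∀ y L → All (λ z → ¬ z ≤ᵥ y) L → x ∈ L →
                      Lex-< _≡_ BadExtension (slices (y ∷ L)) (slices L)
    slices-decrease y L bad x∈L =
      map-Lex-< _ _ (λ k → slice-∷ (proj₁ k) (proj₂ k) y L bad)
        (VecAny.map (λ { refl → slice-∷-own i y L bad }) (∈-fromList⁺ key∈keys))
      where
      x≰y : ¬ x ≤ᵥ y
      x≰y = All.lookup bad x∈L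
      witness : ∃ λ i → ¬ lookup x i ≤ lookup y i
      witness = ¬∀⟶∃¬ (suc n) _ (λ j → lookup x j ℕ.≤? lookup y j) x≰y
      i : Fin (suc n)
      i = proj₁ witness
      yᵢ<xᵢ : lookup y i < lookup x i
      yᵢ<xᵢ = ℕP.≰⇒> (proj₂ witness)
      key∈keys : (i , lookup y i) ∈ keys
      key∈keys = ∈-concatMap⁺ _ (Any.map (λ { refl → ∈-map⁺ (i ,_) (∈-upTo⁺ yᵢ<xᵢ) }) (∈-allFin i))

    acc-slices : ∀ L → x ∈ L → Acc (Lex-< _≡_ BadExtension) (slices L) → Acc BadExtension L
    acc-slices L x∈L (acc rs) =
      acc λ { (y , refl , bad) → acc-slices (y ∷ L) (there x∈L) (rs (slices-decrease y L bad x∈L)) }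

dickson : ∀ n → WellFounded (BadExtension {n})
dickson zero L = acc λ { (_ , refl , _) → acc λ { (_ , refl , (z≰y ∷ _)) → ⊥-elim (z≰y λ ()) } }
dickson (suc n) L = acc λ { (x , refl , _) →
  acc-slices x (x ∷ L) (here refl) (<-wellFounded trans (λ { refl → id }) (dickson n) _) }

module _ {n : ℕ} where

  ·ₘ-comm : (a b : Mon n) → a ·ₘ b ≡ b ·ₘ a
  ·ₘ-comm = zipWith-comm ℕP.+-comm

  ·ₘ-assoc : (a b c : Mon n) → (a ·ₘ b) ·ₘ c ≡ a ·ₘ (b ·ₘ c)
  ·ₘ-assoc = zipWith-assoc ℕP.+-assoc

  ·ₘ-identityˡ : (a : Mon n) → oneₘ ·ₘ a ≡ a
  ·ₘ-identityˡ = zipWith-identityˡ ℕP.+-identityˡ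

_∸ₘ_ : ∀ {n} → Mon n → Mon n → Mon n
a ∸ₘ b = Vec.zipWith ℕ._∸_ a b

·ₘ-cancelˡ : ∀ {n} (a b c : Mon n) → a ·ₘ b ≡ a ·ₘ c → b ≡ c
·ₘ-cancelˡ Vec.[] Vec.[] Vec.[] _ = refl
·ₘ-cancelˡ (x Vec.∷ a) (y Vec.∷ b) (z Vec.∷ c) eq =
  cong₂ Vec._∷_ (ℕP.+-cancelˡ-≡ x y z (cong Vec.head eq)) (·ₘ-cancelˡ a b c (cong Vec.tail eq))

[a·ₘb]∸ₘa≡b : ∀ {n} (a b : Mon n) → (a ·ₘ b) ∸ₘ a ≡ b
[a·ₘb]∸ₘa≡b Vec.[] Vec.[] = refl
[a·ₘb]∸ₘa≡b (x Vec.∷ a) (y Vec.∷ b) = cong₂ Vec._∷_ (ℕP.m+n∸m≡n x y) ([a·ₘb]∸ₘa≡b a b)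

_∣ₘ?_ : ∀ {n} (a m : Mon n) → Dec (a ∣ₘ m)
a ∣ₘ? m with ≡-dec ℕ._≟_ (a ·ₘ (m ∸ₘ a)) m
... | yes a·[m∸a]≡m = yes (m ∸ₘ a , a·[m∸a]≡m)
... | no a·[m∸a]≢m = no λ { (b , refl) → a·[m∸a]≢m (cong (a ·ₘ_) ([a·ₘb]∸ₘa≡b a b)) }

∣ₘ-trans : ∀ {n} {a b c : Mon n} → a ∣ₘ b → b ∣ₘ c → a ∣ₘ c
∣ₘ-trans {a = a} (x , refl) (y , refl) = x ·ₘ y , sym (·ₘ-assoc a x y)

≤ᵥ⇒∣ₘ : ∀ {n} {a b : Mon n} → a ≤ᵥ b → a ∣ₘ b
≤ᵥ⇒∣ₘ {a = a} {b} a≤b = b ∸ₘ a , a·[b∸a]≡b a b a≤b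
  where
  a·[b∸a]≡b : ∀ {k} (a b : Mon k) → a ≤ᵥ b → a ·ₘ (b ∸ₘ a) ≡ b
  a·[b∸a]≡b Vec.[] Vec.[] _ = refl
  a·[b∸a]≡b (x Vec.∷ a) (y Vec.∷ b) a≤b =
    cong₂ Vec._∷_ (ℕP.m+[n∸m]≡n (a≤b Fin.zero)) (a·[b∸a]≡b a b (λ j → a≤b (Fin.suc j)))

module _ {n : ℕ} where

  ≈-isEquivalence : IsEquivalence (_≈_ {n})
  ≈-isEquivalence = record
    { refl = λ _ → refl
    ; sym = λ p≈q m → sym (p≈q m)
    ; trans = λ p≈q q≈r m → trans (p≈q m) (q≈r m)
    }

≈-setoid : ℕ → Setoid _ _
≈-setoid n = record { isEquivalence = ≈-isEquivalence {n} }

module ≈-Reasoning {n : ℕ} = Relation.Binary.Reasoning.Setoid (≈-setoid n)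

module _ {n : ℕ} where

  coeff-+ₚ : (p q : Poly n) (m : Mon n) → coeff (p +ₚ q) m ≡ coeff p m ℚ.+ coeff q m
  coeff-+ₚ [] q m = sym (ℚP.+-identityˡ _)
  coeff-+ₚ ((c , m′) ∷ p) q m with ≡-dec ℕ._≟_ m′ m
  ... | yes _ = trans (cong (c ℚ.+_) (coeff-+ₚ p q m)) (sym (ℚP.+-assoc c _ _))
  ... | no  _ = coeff-+ₚ p q m

  coeff-·ₚ : (c : ℚ) (p : Poly n) (m : Mon n) → coeff (c ·ₚ p) m ≡ c ℚ.* coeff p m
  coeff-·ₚ c [] m = sym (ℚP.*-zeroʳ c)
  coeff-·ₚ c ((a , m′) ∷ p) m with ≡-dec ℕ._≟_ m′ m
  ... | yes _ = trans (cong (c ℚ.* a ℚ.+_) (coeff-·ₚ c p m)) (sym (ℚP.*-distribˡ-+ c _ _))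
  ... | no  _ = coeff-·ₚ c p m

  coeff--ₚ : (p : Poly n) (m : Mon n) → coeff (-ₚ p) m ≡ ℚ.- coeff p m
  coeff--ₚ [] m = refl
  coeff--ₚ ((a , m′) ∷ p) m with ≡-dec ℕ._≟_ m′ m
  ... | yes _ = trans (cong (ℚ.- a ℚ.+_) (coeff--ₚ p m)) (sym (ℚP.neg-distrib-+ a _))
  ... | no  _ = coeff--ₚ p m

  coeff-ₚ : (p q : Poly n) (m : Mon n) → coeff (p -ₚ q) m ≡ coeff p m ℚ.- coeff q m
  coeff-ₚ p q m = trans (coeff-+ₚ p (-ₚ q) m) (cong (coeff p m ℚ.+_) (coeff--ₚ q m))

  +ₚ-cong : {p p′ q q′ : Poly n} → p ≈ p′ → q ≈ q′ → p +ₚ q ≈ p′ +ₚ q′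
  +ₚ-cong {p} {p′} {q} {q′} p≈p′ q≈q′ m = begin
    coeff (p +ₚ q) m          ≡⟨ coeff-+ₚ p q m ⟩
    coeff p m ℚ.+ coeff q m   ≡⟨ cong₂ ℚ._+_ (p≈p′ m) (q≈q′ m) ⟩
    coeff p′ m ℚ.+ coeff q′ m ≡⟨ coeff-+ₚ p′ q′ m ⟨
    coeff (p′ +ₚ q′) m        ∎
    where open ≡-Reasoning

  ·ₚ-cong : ∀ c {p p′ : Poly n} → p ≈ p′ → c ·ₚ p ≈ c ·ₚ p′
  ·ₚ-cong c {p} {p′} p≈p′ m = trans (coeff-·ₚ c p m) (trans (cong (c ℚ.*_) (p≈p′ m)) (sym (coeff-·ₚ c p′ m)))

  +ₚ-identityʳ : (p : Poly n) → p +ₚ 0ₚ ≈ p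
  +ₚ-identityʳ p m = cong (λ q → coeff q m) (List.++-identityʳ p)

  +ₚ-interchange : (a b c d : Poly n) → (a +ₚ b) +ₚ (c +ₚ d) ≈ (a +ₚ c) +ₚ (b +ₚ d)
  +ₚ-interchange a b c d m
    rewrite coeff-+ₚ (a +ₚ b) (c +ₚ d) m | coeff-+ₚ (a +ₚ c) (b +ₚ d) m
          | coeff-+ₚ a b m | coeff-+ₚ c d m | coeff-+ₚ a c m | coeff-+ₚ b d m =
    solve 4 (λ a b c d → (a :+ b) :+ (c :+ d) := (a :+ c) :+ (b :+ d)) refl
      (coeff a m) (coeff b m) (coeff c m) (coeff d m)
    where open +-*-Solver

  p+[-[p-r]]≈r : (p r : Poly n) → p +ₚ -ₚ (p -ₚ r) ≈ r
  p+[-[p-r]]≈r p r m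
    rewrite coeff-+ₚ p (-ₚ (p -ₚ r)) m | coeff--ₚ (p -ₚ r) m | coeff-ₚ p r m =
    solve 2 (λ p r → p :+ :- (p :- r) := r) refl (coeff p m) (coeff r m)
    where open +-*-Solver

  +ₚ-inverseʳ : (p : Poly n) → p +ₚ -ₚ p ≈ 0ₚ
  +ₚ-inverseʳ p m = trans (coeff-+ₚ p (-ₚ p) m)
    (trans (cong (coeff p m ℚ.+_) (coeff--ₚ p m)) (ℚP.+-inverseʳ (coeff p m)))

  +ₚ≈0⇒≈-ₚ : (p q : Poly n) → p +ₚ q ≈ 0ₚ → q ≈ -ₚ p
  +ₚ≈0⇒≈-ₚ p q p+q≈0 m = trans
    (inverseʳ-unique (coeff p m) (coeff q m) (trans (sym (coeff-+ₚ p q m)) (p+q≈0 m)))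
    (sym (coeff--ₚ p m))

  p-r+r≈p : (p r : Poly n) → p -ₚ r +ₚ r ≈ p
  p-r+r≈p p r m rewrite coeff-+ₚ (p -ₚ r) r m | coeff-ₚ p r m =
    solve 2 (λ p r → (p :- r) :+ r := p) refl (coeff p m) (coeff r m)
    where open +-*-Solver

  ·ₚ-identityˡ : (p : Poly n) → 1ℚ ·ₚ p ≈ p
  ·ₚ-identityˡ p m = trans (coeff-·ₚ 1ℚ p m) (ℚP.*-identityˡ _)

  -- Multiplication by the term a·Xᵘ; (t ∷ r) *ₚ q unfolds to t ⊙ q +ₚ r *ₚ q.
  infixr 7 _⊙_
  _⊙_ : ℚ × Mon n → Poly n → Poly n
  (a , u) ⊙ q = map (λ (b , v) → (a ℚ.* b , u ·ₘ v)) q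

  coeff-⊙-·ₘ : ∀ a u (q : Poly n) v → coeff ((a , u) ⊙ q) (u ·ₘ v) ≡ a ℚ.* coeff q v
  coeff-⊙-·ₘ a u [] v = sym (ℚP.*-zeroʳ a)
  coeff-⊙-·ₘ a u ((b , w) ∷ q) v with ≡-dec ℕ._≟_ (u ·ₘ w) (u ·ₘ v) | ≡-dec ℕ._≟_ w v
  ... | yes _ | yes _ = trans (cong (a ℚ.* b ℚ.+_) (coeff-⊙-·ₘ a u q v)) (sym (ℚP.*-distribˡ-+ a _ _))
  ... | yes uw≡uv | no w≢v = contradiction (·ₘ-cancelˡ u w v uw≡uv) w≢v
  ... | no uw≢uv | yes w≡v = contradiction (cong (u ·ₘ_) w≡v) uw≢uv
  ... | no _ | no _ = coeff-⊙-·ₘ a u q v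

  coeff-⊙-∤ : ∀ a u (q : Poly n) m → ¬ u ∣ₘ m → coeff ((a , u) ⊙ q) m ≡ 0ℚ
  coeff-⊙-∤ a u [] m u∤m = refl
  coeff-⊙-∤ a u ((b , w) ∷ q) m u∤m with ≡-dec ℕ._≟_ (u ·ₘ w) m
  ... | yes uw≡m = contradiction (w , uw≡m) u∤m
  ... | no _ = coeff-⊙-∤ a u q m u∤m

  ⊙-cong : ∀ t {q q′ : Poly n} → q ≈ q′ → t ⊙ q ≈ t ⊙ q′
  ⊙-cong (a , u) {q} {q′} q≈q′ m with u ∣ₘ? m
  ... | yes (v , refl) =
    trans (coeff-⊙-·ₘ a u q v) (trans (cong (a ℚ.*_) (q≈q′ v)) (sym (coeff-⊙-·ₘ a u q′ v)))
  ... | no u∤m = trans (coeff-⊙-∤ a u q m u∤m) (sym (coeff-⊙-∤ a u q′ m u∤m))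

  *ₚ-congˡ : ∀ r {q q′ : Poly n} → q ≈ q′ → r *ₚ q ≈ r *ₚ q′
  *ₚ-congˡ [] q≈q′ = λ _ → refl
  *ₚ-congˡ (t ∷ r) {q} {q′} q≈q′ =
    +ₚ-cong {p = t ⊙ q} {t ⊙ q′} {r *ₚ q} {r *ₚ q′} (⊙-cong t {q} {q′} q≈q′) (*ₚ-congˡ r q≈q′)

  *ₚ-distribˡ-+ₚ : (r p q : Poly n) → r *ₚ (p +ₚ q) ≈ r *ₚ p +ₚ r *ₚ q
  *ₚ-distribˡ-+ₚ [] p q = λ _ → refl
  *ₚ-distribˡ-+ₚ (t ∷ r) p q = begin
    t ⊙ (p +ₚ q) +ₚ r *ₚ (p +ₚ q)           ≡⟨ cong (_+ₚ r *ₚ (p +ₚ q)) (List.map-++ _ p q) ⟩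
    (t ⊙ p +ₚ t ⊙ q) +ₚ r *ₚ (p +ₚ q)        ≈⟨ +ₚ-cong {p = t ⊙ p +ₚ t ⊙ q} {t ⊙ p +ₚ t ⊙ q} {r *ₚ (p +ₚ q)} {r *ₚ p +ₚ r *ₚ q}
                                                   (λ _ → refl) (*ₚ-distribˡ-+ₚ r p q) ⟩
    (t ⊙ p +ₚ t ⊙ q) +ₚ (r *ₚ p +ₚ r *ₚ q)   ≈⟨ +ₚ-interchange (t ⊙ p) (t ⊙ q) (r *ₚ p) (r *ₚ q) ⟩
    (t ⊙ p +ₚ r *ₚ p) +ₚ (t ⊙ q +ₚ r *ₚ q)   ∎
    where open ≈-Reasoning

  *ₚ-zeroʳ : (r : Poly n) → r *ₚ 0ₚ ≡ 0ₚ
  *ₚ-zeroʳ [] = refl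
  *ₚ-zeroʳ (t ∷ r) = *ₚ-zeroʳ r

  ⊙-⊙ : ∀ a u b v (q : Poly n) → (a , u) ⊙ ((b , v) ⊙ q) ≡ (a ℚ.* b , u ·ₘ v) ⊙ q
  ⊙-⊙ a u b v q = trans (sym (List.map-∘ q))
    (List.map-cong (λ (c , w) → cong₂ _,_ (sym (ℚP.*-assoc a b c)) (sym (·ₘ-assoc u v w))) q)

  ⊙-*ₚ : ∀ t (p q : Poly n) → (t ⊙ p) *ₚ q ≡ t ⊙ (p *ₚ q)
  ⊙-*ₚ t [] q = refl
  ⊙-*ₚ (a , u) ((b , v) ∷ p) q = begin
    (a ℚ.* b , u ·ₘ v) ⊙ q +ₚ ((a , u) ⊙ p) *ₚ q     ≡⟨ cong₂ _+ₚ_ (sym (⊙-⊙ a u b v q)) (⊙-*ₚ (a , u) p q) ⟩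
    (a , u) ⊙ ((b , v) ⊙ q) +ₚ (a , u) ⊙ (p *ₚ q)    ≡⟨ List.map-++ _ ((b , v) ⊙ q) (p *ₚ q) ⟨
    (a , u) ⊙ ((b , v) ⊙ q +ₚ p *ₚ q)                ∎
    where open ≡-Reasoning

  *ₚ-assoc : (r p q : Poly n) → (r *ₚ p) *ₚ q ≡ r *ₚ (p *ₚ q)
  *ₚ-assoc [] p q = refl
  *ₚ-assoc (t ∷ r) p q = begin
    (t ⊙ p +ₚ r *ₚ p) *ₚ q          ≡⟨ List.concatMap-++ (_⊙ q) (t ⊙ p) (r *ₚ p) ⟩
    (t ⊙ p) *ₚ q +ₚ (r *ₚ p) *ₚ q   ≡⟨ cong₂ _+ₚ_ (⊙-*ₚ t p q) (*ₚ-assoc r p q) ⟩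
    t ⊙ (p *ₚ q) +ₚ r *ₚ (p *ₚ q)   ∎
    where open ≡-Reasoning

  constant-*ₚ : ∀ c (p : Poly n) → ((c , oneₘ) ∷ []) *ₚ p ≡ c ·ₚ p
  constant-*ₚ c p = trans (List.++-identityʳ _)
    (List.map-cong (λ (a , v) → cong (c ℚ.* a ,_) (·ₘ-identityˡ v)) p)

  -ₚ≡-1·ₚ : (p : Poly n) → -ₚ p ≡ (ℚ.- 1ℚ) ·ₚ p
  -ₚ≡-1·ₚ p = List.map-cong (λ (a , v) → cong (_, v)
    (trans (cong ℚ.-_ (sym (ℚP.*-identityˡ a))) (ℚP.neg-distribˡ-* 1ℚ a))) p

  ·ₚ-+ₚ : ∀ c (p q : Poly n) → c ·ₚ (p +ₚ q) ≡ c ·ₚ p +ₚ c ·ₚ q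
  ·ₚ-+ₚ c = List.map-++ _

  ·ₚ-·ₚ : ∀ c d (q : Poly n) → c ·ₚ (d ·ₚ q) ≡ (c ℚ.* d) ·ₚ q
  ·ₚ-·ₚ c d q = trans (sym (List.map-∘ q)) (List.map-cong (λ (a , v) → cong (_, v) (sym (ℚP.*-assoc c d a))) q)

  ≡⇒≈ : {p q : Poly n} → p ≡ q → p ≈ q
  ≡⇒≈ refl _ = refl

  sumₚ-++ : (ps qs : List (Poly n)) → sumₚ (ps ++ qs) ≡ sumₚ ps +ₚ sumₚ qs
  sumₚ-++ [] qs = refl
  sumₚ-++ (p ∷ ps) qs = trans (cong (p +ₚ_) (sumₚ-++ ps qs)) (sym (List.++-assoc p (sumₚ ps) (sumₚ qs)))

  sumₚ-map-++ : ∀ {A : Set} (f : A → Poly n) xs ys →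
                sumₚ (map f (xs ++ ys)) ≡ sumₚ (map f xs) +ₚ sumₚ (map f ys)
  sumₚ-map-++ f xs ys = trans (cong sumₚ (List.map-++ f xs ys)) (sumₚ-++ (map f xs) (map f ys))

  coeff≢0⇒∈monomials : (p : Poly n) {m : Mon n} → coeff p m ≢ 0ℚ → m ∈ map proj₂ p
  coeff≢0⇒∈monomials [] p≢0 = contradiction refl p≢0
  coeff≢0⇒∈monomials ((c , m′) ∷ p) {m} p≢0 with ≡-dec ℕ._≟_ m′ m
  ... | yes refl = here refl
  ... | no _ = there (coeff≢0⇒∈monomials p p≢0)

  ≈-stable : {p q : Poly n} → ¬ ¬ p ≈ q → p ≈ q
  ≈-stable {p} {q} ¬¬p≈q m = decidable-stable (coeff p m ℚ.≟ coeff q m) λ pₘ≢qₘ → ¬¬p≈q λ p≈q → pₘ≢qₘ (p≈q m)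

module Cone {n : ℕ} {C : PSet n} (isCone : IsCone C) where

  ∈-resp : Respects≈ C
  ∈-resp = proj₁ isCone

  0∈ : C 0ₚ
  0∈ = proj₁ (proj₂ isCone)

  +-closed : ∀ p q → C p → C q → C (p +ₚ q)
  +-closed = proj₁ (proj₂ (proj₂ isCone))

  ·-closed : ∀ c p → 0ℚ ℚ.≤ c → C p → C (c ·ₚ p)
  ·-closed = proj₂ (proj₂ (proj₂ isCone))

module Ideal {n : ℕ} {I : PSet n} (isIdeal : IsIdeal I) where

  ∈-resp : Respects≈ I
  ∈-resp = proj₁ isIdeal

  0∈ : I 0ₚ
  0∈ = proj₁ (proj₂ isIdeal)

  +-closed : ∀ p q → I p → I q → I (p +ₚ q)
  +-closed = proj₁ (proj₂ (proj₂ isIdeal))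

  *-closed : ∀ r p → I p → I (r *ₚ p)
  *-closed = proj₂ (proj₂ (proj₂ isIdeal))

module _ {n : ℕ} where

  ideal-sum : List (Poly n × Poly n) → Poly n
  ideal-sum ls = sumₚ (map (λ (r , z) → r *ₚ z) ls)

  cone-sum : List (ℚ × Poly n) → Poly n
  cone-sum ls = sumₚ (map (λ (c , q) → c ·ₚ q) ls)

  *ₚ-ideal-sum : (r : Poly n) (ls : List (Poly n × Poly n)) →
                 r *ₚ ideal-sum ls ≈ ideal-sum (map (λ (s , z) → (r *ₚ s , z)) ls)
  *ₚ-ideal-sum r [] = ≡⇒≈ (*ₚ-zeroʳ r)
  *ₚ-ideal-sum r ((s , z) ∷ ls) = begin
    r *ₚ (s *ₚ z +ₚ ideal-sum ls)        ≈⟨ *ₚ-distribˡ-+ₚ r (s *ₚ z) (ideal-sum ls) ⟩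
    r *ₚ (s *ₚ z) +ₚ r *ₚ ideal-sum ls   ≈⟨ +ₚ-cong {p = r *ₚ (s *ₚ z)} {r *ₚ s *ₚ z} {r *ₚ ideal-sum ls}
                                              (≡⇒≈ (sym (*ₚ-assoc r s z))) (*ₚ-ideal-sum r ls) ⟩
    r *ₚ s *ₚ z +ₚ ideal-sum (map (λ (s , z) → (r *ₚ s , z)) ls) ∎
    where open ≈-Reasoning

  ·ₚ-cone-sum : (c : ℚ) (ls : List (ℚ × Poly n)) →
                c ·ₚ cone-sum ls ≡ cone-sum (map (λ (d , q) → (c ℚ.* d , q)) ls)
  ·ₚ-cone-sum c [] = refl
  ·ₚ-cone-sum c ((d , q) ∷ ls) =
    trans (·ₚ-+ₚ c (d ·ₚ q) (cone-sum ls)) (cong₂ _+ₚ_ (·ₚ-·ₚ c d q) (·ₚ-cone-sum c ls))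

  ideal-isIdeal : (Z : List (Poly n)) → IsIdeal (ideal Z)
  ideal-isIdeal Z = ∈-resp , ([] , [] , λ _ → refl) , +-closed , *-closed
    where
    ∈-resp : Respects≈ (ideal Z)
    ∈-resp p q p≈q (ls , ls⊆Z , p≈Σ) = ls , ls⊆Z , λ m → trans (sym (p≈q m)) (p≈Σ m)
    +-closed : ∀ p q → ideal Z p → ideal Z q → ideal Z (p +ₚ q)
    +-closed p q (ls , ls⊆Z , p≈Σ) (ls′ , ls′⊆Z , q≈Σ′) = ls ++ ls′ , ++⁺ ls⊆Z ls′⊆Z , λ m →
      trans (+ₚ-cong {p = p} {ideal-sum ls} {q} {ideal-sum ls′} p≈Σ q≈Σ′ m)
            (sym (≡⇒≈ (sumₚ-map-++ _ ls ls′) m))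
    *-closed : ∀ r p → ideal Z p → ideal Z (r *ₚ p)
    *-closed r p (ls , ls⊆Z , p≈Σ) = _ , map⁺ ls⊆Z , λ m →
      trans (*ₚ-congˡ r {p} {ideal-sum ls} p≈Σ m) (*ₚ-ideal-sum r ls m)

  cone-isCone : (P : List (Poly n)) → IsCone (cone P)
  cone-isCone P = ∈-resp , ([] , [] , λ _ → refl) , +-closed , ·-closed
    where
    ∈-resp : Respects≈ (cone P)
    ∈-resp p q p≈q (ls , ls⊆P , p≈Σ) = ls , ls⊆P , λ m → trans (sym (p≈q m)) (p≈Σ m)
    +-closed : ∀ p q → cone P p → cone P q → cone P (p +ₚ q)
    +-closed p q (ls , ls⊆P , p≈Σ) (ls′ , ls′⊆P , q≈Σ′) = ls ++ ls′ , ++⁺ ls⊆P ls′⊆P , λ m →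
      trans (+ₚ-cong {p = p} {cone-sum ls} {q} {cone-sum ls′} p≈Σ q≈Σ′ m)
            (sym (≡⇒≈ (sumₚ-map-++ _ ls ls′) m))
    ·-closed : ∀ c p → 0ℚ ℚ.≤ c → cone P p → cone P (c ·ₚ p)
    ·-closed c p 0≤c (ls , ls⊆P , p≈Σ) = _ , map⁺ (All.map (λ (0≤d , q∈P) → 0≤c*d 0≤d , q∈P) ls⊆P) , λ m →
      trans (·ₚ-cong c {p} {cone-sum ls} p≈Σ m) (≡⇒≈ (·ₚ-cone-sum c ls) m)
      where
      0≤c*d : ∀ {d} → 0ℚ ℚ.≤ d → 0ℚ ℚ.≤ c ℚ.* d
      0≤c*d {d} 0≤d = ℚP.nonNegative⁻¹ _
        {{ℚP.nonNeg*nonNeg⇒nonNeg c {{ℚ.nonNegative 0≤c}} d {{ℚ.nonNegative 0≤d}}}}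

  ∈⇒ideal : {Z : List (Poly n)} {z : Poly n} → z ∈ Z → ideal Z z
  ∈⇒ideal {z = z} z∈Z = (1ₚ , z) ∷ [] , z∈Z ∷ [] , λ m → sym (begin
    coeff (1ₚ *ₚ z +ₚ 0ₚ) m ≡⟨ +ₚ-identityʳ (1ₚ *ₚ z) m ⟩
    coeff (1ₚ *ₚ z) m       ≡⟨ cong (λ q → coeff q m) (constant-*ₚ 1ℚ z) ⟩
    coeff (1ℚ ·ₚ z) m       ≡⟨ ·ₚ-identityˡ z m ⟩
    coeff z m               ∎)
    where open ≡-Reasoning

  ∈⇒cone : {P : List (Poly n)} {p : Poly n} → p ∈ P → cone P p
  ∈⇒cone {p = p} p∈P = (1ℚ , p) ∷ [] , (ℚP.nonNegative⁻¹ 1ℚ , p∈P) ∷ [] , λ m → sym (begin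
    coeff (1ℚ ·ₚ p +ₚ 0ₚ) m ≡⟨ +ₚ-identityʳ (1ℚ ·ₚ p) m ⟩
    coeff (1ℚ ·ₚ p) m       ≡⟨ ·ₚ-identityˡ p m ⟩
    coeff p m               ∎)
    where open ≡-Reasoning

  ideal-least : {I : PSet n} → IsIdeal I → {Z : List (Poly n)} → All I Z → ideal Z ⊆′ I
  ideal-least {I} (∈-resp , 0∈ , +-closed , *-closed) Z⊆I p (ls , ls⊆Z , p≈Σ) =
    ∈-resp _ p (λ m → sym (p≈Σ m)) (sum∈ ls ls⊆Z)
    where
    sum∈ : ∀ ls → All (λ (r , z) → z ∈ _) ls → I (ideal-sum ls)
    sum∈ [] [] = 0∈
    sum∈ ((r , z) ∷ ls) (z∈Z ∷ ls⊆Z) = +-closed _ _ (*-closed r z (All.lookup Z⊆I z∈Z)) (sum∈ ls ls⊆Z)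

  cone-least : {C : PSet n} → IsCone C → {P : List (Poly n)} → All C P → cone P ⊆′ C
  cone-least {C} (∈-resp , 0∈ , +-closed , ·-closed) P⊆C p (ls , ls⊆P , p≈Σ) =
    ∈-resp _ p (λ m → sym (p≈Σ m)) (sum∈ ls ls⊆P)
    where
    sum∈ : ∀ ls → All (λ (c , q) → 0ℚ ℚ.≤ c × q ∈ _) ls → C (cone-sum ls)
    sum∈ [] [] = 0∈
    sum∈ ((c , q) ∷ ls) ((0≤c , q∈P) ∷ ls⊆P) = +-closed _ _ (·-closed c q 0≤c (All.lookup P⊆C q∈P)) (sum∈ ls ls⊆P)

  IsIdeal-resp-≐′ : {S T : PSet n} → S ≐′ T → IsIdeal S → IsIdeal T
  IsIdeal-resp-≐′ (S⊆T , T⊆S) (∈-resp , 0∈ , +-closed , *-closed) =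
    (λ p q p≈q p∈T → S⊆T q (∈-resp p q p≈q (T⊆S p p∈T))) ,
    S⊆T _ 0∈ ,
    (λ p q p∈T q∈T → S⊆T _ (+-closed p q (T⊆S p p∈T) (T⊆S q q∈T))) ,
    (λ r p p∈T → S⊆T _ (*-closed r p (T⊆S p p∈T)))

  ideal-·-closed : {I : PSet n} → IsIdeal I → ∀ c p → I p → I (c ·ₚ p)
  ideal-·-closed (∈-resp , _ , _ , *-closed) c p p∈I =
    ∈-resp _ _ (≡⇒≈ (constant-*ₚ c p)) (*-closed ((c , oneₘ) ∷ []) p p∈I)

  ideal--closed : {I : PSet n} → IsIdeal I → ∀ p → I p → I (-ₚ p)
  ideal--closed isIdeal@(∈-resp , _) p p∈I =
    ∈-resp _ _ (≡⇒≈ (sym (-ₚ≡-1·ₚ p))) (ideal-·-closed isIdeal (ℚ.- 1ℚ) p p∈I)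

  cone-mono : ∀ {P P′ : List (Poly n)} → P ⊆ P′ → cone P ⊆′ cone P′
  cone-mono P⊆P′ p (ls , ls⊆P , p≈Σ) = ls , All.map (λ (0≤c , q∈P) → 0≤c , P⊆P′ q∈P) ls⊆P , p≈Σ

  algCone-mono : ∀ {Z P P′ : List (Poly n)} → P ⊆ P′ → algCone Z P ⊆′ algCone Z P′
  algCone-mono P⊆P′ p (a , b , a∈ , b∈ , p≈a+b) = a , b , a∈ , cone-mono P⊆P′ b b∈ , p≈a+b

  module _ (Z P : List (Poly n)) where

    algCone-isCone : IsCone (algCone Z P)
    algCone-isCone = ∈-resp , (0ₚ , 0ₚ , 0∈ᵢ , 0∈ᶜ , λ _ → refl) , +-closed , ·-closed
      where
      open ≈-Reasoning
      open Ideal (ideal-isIdeal Z) using () renaming (0∈ to 0∈ᵢ; +-closed to +-closedᵢ)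
      open Cone (cone-isCone P) using () renaming (0∈ to 0∈ᶜ; +-closed to +-closedᶜ; ·-closed to ·-closedᶜ)
      ∈-resp : Respects≈ (algCone Z P)
      ∈-resp p q p≈q (a , b , a∈ , b∈ , p≈a+b) = a , b , a∈ , b∈ , λ m → trans (sym (p≈q m)) (p≈a+b m)
      +-closed : ∀ p q → algCone Z P p → algCone Z P q → algCone Z P (p +ₚ q)
      +-closed p q (a , b , a∈ , b∈ , p≈a+b) (a′ , b′ , a′∈ , b′∈ , q≈a′+b′) =
        a +ₚ a′ , b +ₚ b′ ,
        +-closedᵢ a a′ a∈ a′∈ , +-closedᶜ b b′ b∈ b′∈ ,
        (begin
          p +ₚ q                    ≈⟨ +ₚ-cong {p = p} {a +ₚ b} {q} {a′ +ₚ b′} p≈a+b q≈a′+b′ ⟩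
          (a +ₚ b) +ₚ (a′ +ₚ b′)    ≈⟨ +ₚ-interchange a b a′ b′ ⟩
          (a +ₚ a′) +ₚ (b +ₚ b′)    ∎)
      ·-closed : ∀ c p → 0ℚ ℚ.≤ c → algCone Z P p → algCone Z P (c ·ₚ p)
      ·-closed c p 0≤c (a , b , a∈ , b∈ , p≈a+b) =
        c ·ₚ a , c ·ₚ b , ideal-·-closed (ideal-isIdeal Z) c a a∈ ,
        ·-closedᶜ c b 0≤c b∈ ,
        (begin
          c ·ₚ p           ≈⟨ ·ₚ-cong c {p} {a +ₚ b} p≈a+b ⟩
          c ·ₚ (a +ₚ b)    ≡⟨ ·ₚ-+ₚ c a b ⟩
          c ·ₚ a +ₚ c ·ₚ b ∎)

    ideal⊆algCone : ideal Z ⊆′ algCone Z P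
    ideal⊆algCone a a∈ = a , 0ₚ , a∈ , Cone.0∈ (cone-isCone P) , λ m → sym (+ₚ-identityʳ a m)

    cone⊆algCone : cone P ⊆′ algCone Z P
    cone⊆algCone b b∈ = 0ₚ , b , Ideal.0∈ (ideal-isIdeal Z) , b∈ , λ _ → refl

    normal-form∈algCone : ∀ p r → ideal Z (p -ₚ r) → cone P r → algCone Z P p
    normal-form∈algCone p r p-r∈⟨Z⟩ r∈cone = p -ₚ r , r , p-r∈⟨Z⟩ , r∈cone , λ m → sym (p-r+r≈p p r m)

    algCone-least : {C : PSet n} → IsCone C → ideal Z ⊆′ C → All C P → algCone Z P ⊆′ C
    algCone-least isCone@(∈-resp , _ , +-closed , _) Z⊆C P⊆C p (a , b , a∈ , b∈ , p≈a+b) =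
      ∈-resp _ p (λ m → sym (p≈a+b m)) (+-closed a b (Z⊆C a a∈) (cone-least isCone P⊆C b b∈))

Star-preserves : ∀ {A : Set} {R : Rel A 0ℓ} (I : A → Set) → (∀ {s s′} → R s s′ → I s → I s′) →
                 ∀ {s s′} → Star R s s′ → I s → I s′
Star-preserves I preserves ε = id
Star-preserves I preserves (r ◅ rs) = Star-preserves I preserves rs ∘ preserves r

module _ {n : ℕ} (ord : MonomialOrder n) where

  open MonomialOrder ord renaming (_≼_ to infix 4 _≼_)

  infix 4 _≺_
  _≺_ : Mon n → Mon n → Set
  a ≺ b = a ≼ b × a ≢ b

  ≼-totalOrder : TotalOrder _ _ _
  ≼-totalOrder = record { isTotalOrder = isTotalOrder }

  support : Poly n → List (Mon n)
  support p = filter (λ m → ¬? (coeff p m ℚ.≟ 0ℚ)) (map proj₂ p)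

  zero-or-LM : (p : Poly n) → p ≈ 0ₚ ⊎ ∃ (IsLM ord p)
  zero-or-LM p = from-support (support p) (all-filter _ (map proj₂ p))
    (λ m pₘ≢0 → ∈-filter⁺ _ (coeff≢0⇒∈monomials p pₘ≢0) pₘ≢0)
    where
    open import Data.List.Extrema ≼-totalOrder using (max; f[⊥]≤f[argmax]; f[xs]≤f[argmax]; argmax-all)
    from-support : (S : List (Mon n)) → All (λ m → coeff p m ≢ 0ℚ) S →
                   (∀ m → coeff p m ≢ 0ℚ → m ∈ S) → p ≈ 0ₚ ⊎ ∃ (IsLM ord p)
    from-support [] _ complete = inj₁ λ m →
      decidable-stable (coeff p m ℚ.≟ 0ℚ) λ pₘ≢0 → case complete m pₘ≢0 of λ ()
    from-support (s ∷ S) nonzero complete = inj₂ (max s S , argmax-all id s≢0 S≢0 , λ m pₘ≢0 →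
      All.lookup (f[⊥]≤f[argmax] {f = id} s S ∷ f[xs]≤f[argmax] {f = id} s S) (complete m pₘ≢0))
      where
      s≢0 = All.head nonzero
      S≢0 = All.tail nonzero

  DivisibleByLM : List (Poly n) → Mon n → Set
  DivisibleByLM G m = Any (λ g → ∃ λ u → IsLM ord g u × u ∣ₘ m) G

  Irreducible : List (Poly n) → Poly n → Set
  Irreducible G r = ∀ m → coeff r m ≢ 0ℚ → All (λ g → ∀ u → IsLM ord g u → ¬ (u ∣ₘ m)) G

  Irreducible⇒¬DivisibleByLM : ∀ {G m} r → Irreducible G r → coeff r m ≢ 0ℚ → ¬ DivisibleByLM G m
  Irreducible⇒¬DivisibleByLM r r-irr rₘ≢0 =
    All¬⇒¬Any (All.map (λ ¬lm∣m (u , lm , u∣m) → ¬lm∣m u lm u∣m) (r-irr _ rₘ≢0))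

  Irreducible-isCone : (G : List (Poly n)) → IsCone (Irreducible G)
  Irreducible-isCone G = ∈-resp , (λ _ 0≢0 → contradiction refl 0≢0) , +-closed , ·-closed
    where
    ∈-resp : Respects≈ (Irreducible G)
    ∈-resp p q p≈q p-irr m qₘ≢0 = p-irr m λ pₘ≡0 → qₘ≢0 (trans (sym (p≈q m)) pₘ≡0)
    +-closed : ∀ p q → Irreducible G p → Irreducible G q → Irreducible G (p +ₚ q)
    +-closed p q p-irr q-irr m [p+q]ₘ≢0 with coeff p m ℚ.≟ 0ℚ
    ... | no pₘ≢0 = p-irr m pₘ≢0
    ... | yes pₘ≡0 = q-irr m λ qₘ≡0 →
      [p+q]ₘ≢0 (trans (coeff-+ₚ p q m) (cong₂ ℚ._+_ pₘ≡0 qₘ≡0))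
    ·-closed : ∀ c p → 0ℚ ℚ.≤ c → Irreducible G p → Irreducible G (c ·ₚ p)
    ·-closed c p _ p-irr m [cp]ₘ≢0 = p-irr m λ pₘ≡0 →
      [cp]ₘ≢0 (trans (coeff-·ₚ c p m) (trans (cong (c ℚ.*_) pₘ≡0) (ℚP.*-zeroʳ c)))

  groebner-irreducible⇒≈0 : ∀ {I G} f → IsGroebnerBasis ord I G → I f → Irreducible G f → f ≈ 0ₚ
  groebner-irreducible⇒≈0 f (_ , lm-divisible) f∈I f-irr with zero-or-LM f
  ... | inj₁ f≈0 = f≈0
  ... | inj₂ (m , lm) = contradiction (lm-divisible f f∈I m lm) (Irreducible⇒¬DivisibleByLM f f-irr (proj₁ lm))

  lm-induction : (S : PSet n) → (∀ f → f ≈ 0ₚ → S f) →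
                 (∀ f m → IsLM ord f m → (∀ f′ → (∀ m′ → IsLM ord f′ m′ → m′ ≺ m) → S f′) → S f) →
                 ∀ f → S f
  lm-induction S ≈0-case lm-case f with zero-or-LM f
  ... | inj₁ f≈0 = ≈0-case f f≈0
  ... | inj₂ (m , lm) = go m (wellOrdered m) f lm
    where
    go : ∀ m → Acc _≺_ m → ∀ f → IsLM ord f m → S f
    go m (acc below) f lm = lm-case f m lm λ f′ f′≺m → case zero-or-LM f′ of λ where
      (inj₁ f′≈0) → ≈0-case f′ f′≈0
      (inj₂ (m′ , lm′)) → go m′ (below (f′≺m m′ lm′)) f′ lm′

  ⊙-support-≼ : ∀ (a : ℚ) w g u → IsLM ord g u →
                ∀ x → coeff ((a , w) ⊙ g) x ≢ 0ℚ → x ≼ w ·ₘ u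
  ⊙-support-≼ a w g u (_ , g≼u) x [wg]ₓ≢0 with w ∣ₘ? x
  ... | no w∤x = contradiction (coeff-⊙-∤ a w g x w∤x) [wg]ₓ≢0
  ... | yes (v , refl) = subst₂ _≼_ (·ₘ-comm v w) (·ₘ-comm u w) (multiplicative v u w (g≼u v gᵥ≢0))
    where
    gᵥ≢0 : coeff g v ≢ 0ℚ
    gᵥ≢0 gᵥ≡0 = [wg]ₓ≢0 (trans (coeff-⊙-·ₘ a w g v) (trans (cong (a ℚ.*_) gᵥ≡0) (ℚP.*-zeroʳ a)))

  cancel-LM : ∀ f h m → IsLM ord f m → (∀ x → coeff h x ≢ 0ℚ → x ≼ m) → coeff h m ≡ coeff f m →
              ∀ m′ → IsLM ord (f -ₚ h) m′ → m′ ≺ m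
  cancel-LM f h m (_ , f≼m) h≼m hₘ≡fₘ m′ ([f-h]ₘ′≢0 , _) = m′≼m , m′≢m
    where
    m′≼m : m′ ≼ m
    m′≼m with coeff f m′ ℚ.≟ 0ℚ
    ... | no fₘ′≢0 = f≼m m′ fₘ′≢0
    ... | yes fₘ′≡0 = h≼m m′ λ hₘ′≡0 → [f-h]ₘ′≢0
      (trans (coeff-ₚ f h m′) (cong₂ ℚ._-_ fₘ′≡0 hₘ′≡0))
    m′≢m : m′ ≢ m
    m′≢m refl = [f-h]ₘ′≢0 (trans (coeff-ₚ f h m) (trans (cong (λ c → coeff f m ℚ.- c) hₘ≡fₘ) (ℚP.+-inverseʳ (coeff f m))))

  module _ {I : PSet n} (isIdeal : IsIdeal I) {G : List (Poly n)} (groebner : IsGroebnerBasis ord I G) where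

    open Ideal isIdeal

    -- One step of the division algorithm: a multiple of a basis element cancels the leading term of f.
    reducer : ∀ {f m} → I f → IsLM ord f m →
              ∃ λ h → I h × ideal G h × (∀ x → coeff h x ≢ 0ℚ → x ≼ m) × coeff h m ≡ coeff f m
    reducer {f} {m} f∈I lm with find (proj₂ groebner f f∈I m lm)
    ... | g , g∈G , u , lm-g@(gᵤ≢0 , _) , (w , u·w≡m) = h , h∈I , h∈⟨G⟩ , h≼m , hₘ≡fₘ
      where
      instance
        gᵤ-nonZero : ℚ.NonZero (coeff g u)
        gᵤ-nonZero = ℚ.≢-nonZero gᵤ≢0
      k : ℚ
      k = coeff f m ℚ.* ℚ.1/ coeff g u
      h : Poly n
      h = ((k , w) ∷ []) *ₚ g
      h∈I : I h
      h∈I = *-closed ((k , w) ∷ []) g (All.lookup (proj₁ groebner) g∈G)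
      h∈⟨G⟩ : ideal G h
      h∈⟨G⟩ = Ideal.*-closed (ideal-isIdeal G) ((k , w) ∷ []) g (∈⇒ideal g∈G)
      w·u≡m : w ·ₘ u ≡ m
      w·u≡m = trans (·ₘ-comm w u) u·w≡m
      h≼m : ∀ x → coeff h x ≢ 0ℚ → x ≼ m
      h≼m x hₓ≢0 = subst (x ≼_) w·u≡m
        (⊙-support-≼ k w g u lm-g x λ [wg]ₓ≡0 → hₓ≢0 (trans (+ₚ-identityʳ ((k , w) ⊙ g) x) [wg]ₓ≡0))
      hₘ≡fₘ : coeff h m ≡ coeff f m
      hₘ≡fₘ = begin
        coeff h m                                        ≡⟨ +ₚ-identityʳ ((k , w) ⊙ g) m ⟩
        coeff ((k , w) ⊙ g) m                            ≡⟨ cong (coeff ((k , w) ⊙ g)) w·u≡m ⟨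
        coeff ((k , w) ⊙ g) (w ·ₘ u)                     ≡⟨ coeff-⊙-·ₘ k w g u ⟩
        k ℚ.* coeff g u                                  ≡⟨ ℚP.*-assoc (coeff f m) _ _ ⟩
        coeff f m ℚ.* (ℚ.1/ coeff g u ℚ.* coeff g u)     ≡⟨ cong (coeff f m ℚ.*_) (ℚP.*-inverseˡ (coeff g u)) ⟩
        coeff f m ℚ.* 1ℚ                                 ≡⟨ ℚP.*-identityʳ (coeff f m) ⟩
        coeff f m                                        ∎
        where open ≡-Reasoning

    groebner-generates : I ⊆′ ideal G
    groebner-generates = lm-induction (λ f → I f → ideal G f) ≈0-case lm-case
      where
      open Ideal (ideal-isIdeal G) renaming (∈-resp to ∈⟨G⟩-resp; 0∈ to 0∈⟨G⟩; +-closed to +-closed⟨G⟩)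
      ≈0-case : ∀ f → f ≈ 0ₚ → I f → ideal G f
      ≈0-case f f≈0 _ = ∈⟨G⟩-resp 0ₚ f (λ m → sym (f≈0 m)) 0∈⟨G⟩
      lm-case : ∀ f m → IsLM ord f m → (∀ f′ → (∀ m′ → IsLM ord f′ m′ → m′ ≺ m) → I f′ → ideal G f′) →
                I f → ideal G f
      lm-case f m lm ih f∈I = case reducer f∈I lm of λ (h , h∈I , h∈⟨G⟩ , h≼m , hₘ≡fₘ) →
        ∈⟨G⟩-resp ((f -ₚ h) +ₚ h) f (p-r+r≈p f h)
          (+-closed⟨G⟩ (f -ₚ h) h
            (ih (f -ₚ h) (cancel-LM f h m lm h≼m hₘ≡fₘ) (+-closed f (-ₚ h) f∈I (ideal--closed isIdeal h h∈I)))
            h∈⟨G⟩)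

  DivisibleByLM-∣ₘ : ∀ {G l m} → DivisibleByLM G l → l ∣ₘ m → DivisibleByLM G m
  DivisibleByLM-∣ₘ l-div l∣m = Any.map (λ (u , lm , u∣l) → u , lm , ∣ₘ-trans u∣l l∣m) l-div

  DivisibleByLM-transfer : ∀ {I G Z m} → IsGroebnerBasis ord I G → All I Z →
                           DivisibleByLM Z m → DivisibleByLM G m
  DivisibleByLM-transfer (_ , lm-divisible) Z⊆I m-div with find m-div
  ... | g , g∈Z , u , lm , u∣m = DivisibleByLM-∣ₘ (lm-divisible g (All.lookup Z⊆I g∈Z) u lm) u∣m

  groebner-of-generated : ∀ {I G} → IsIdeal I → IsGroebnerBasis ord I G → IsGroebnerBasis ord (ideal G) G
  groebner-of-generated isIdeal groebner@(G⊆I , lm-divisible) =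
    All.tabulate ∈⇒ideal , λ f f∈⟨G⟩ → lm-divisible f (ideal-least isIdeal G⊆I f f∈⟨G⟩)

  Reduced⇒Irreducible : ∀ {G P P′} → Reduced ord G P P′ → All (Irreducible G) P′
  Reduced⇒Irreducible [] = []
  Reduced⇒Irreducible (drop _ _ red) = Reduced⇒Irreducible red
  Reduced⇒Irreducible (keep (_ , r-irr) _ red) = r-irr ∷ Reduced⇒Irreducible red

  Reduced⇒algCone : ∀ {G P P′} → Reduced ord G P P′ → All (algCone G P′) P
  Reduced⇒algCone [] = []
  Reduced⇒algCone {G} {P′ = P′} (drop {p} {r} (p-r∈⟨G⟩ , _) r≈0 red) =
    normal-form∈algCone G P′ p r p-r∈⟨G⟩
      (Cone.∈-resp (cone-isCone P′) 0ₚ r (λ m → sym (r≈0 m)) (Cone.0∈ (cone-isCone P′)))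
    ∷ Reduced⇒algCone red
  Reduced⇒algCone {G} (keep {p} {r} {P' = P′} (p-r∈⟨G⟩ , _) _ red) =
    normal-form∈algCone G (r ∷ P′) p r p-r∈⟨G⟩ (∈⇒cone (here refl))
    ∷ All.map (λ {q} → algCone-mono there q) (Reduced⇒algCone red)

  -- The saturation loop

  module _ {Z G : List (Poly n)} {t : Poly n} (groebner : IsGroebnerBasis ord (ideal (t ∷ Z)) G) where

    ideal-⊆-step : ideal Z ⊆′ ideal G
    ideal-⊆-step = ideal-least (ideal-isIdeal G)
      (All.tabulate λ {z} z∈Z → groebner-generates (ideal-isIdeal (t ∷ Z)) groebner z (∈⇒ideal (there z∈Z)))

    DivisibleByLM-step : ∀ {m} → DivisibleByLM Z m → DivisibleByLM G m
    DivisibleByLM-step = DivisibleByLM-transfer groebner (All.tabulate λ z∈Z → ∈⇒ideal (there z∈Z))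

  record Invariant (Q Z P : List (Poly n)) : Set where
    field
      groebner    : IsGroebnerBasis ord (ideal Z) Z
      irreducible : All (Irreducible Z) P
      contains-Q  : All (algCone Z P) (1ₚ ∷ Q)

  invariant-init : (Q : List (Poly n)) → Invariant Q [] (1ₚ ∷ Q)
  invariant-init Q = record
    { groebner    = [] , λ f f∈⟨[]⟩ m (fₘ≢0 , _) → contradiction (⟨[]⟩≈0 f f∈⟨[]⟩ m) fₘ≢0
    ; irreducible = All.tabulate λ _ _ _ → []
    ; contains-Q  = All.tabulate λ {p} p∈ → cone⊆algCone [] _ p (∈⇒cone p∈)
    }
    where
    ⟨[]⟩≈0 : ∀ f → ideal [] f → f ≈ 0ₚ
    ⟨[]⟩≈0 f ([] , [] , f≈0) = f≈0

  invariant-step : ∀ {Q Z P G P′} → Step ord (Z , P) (G , P′) → Invariant Q Z P → Invariant Q G P′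
  invariant-step {Z = Z} {P} {G} {P′} (step t _ groebner red) inv = record
    { groebner    = groebner-of-generated (ideal-isIdeal (t ∷ Z)) groebner
    ; irreducible = Reduced⇒Irreducible red
    ; contains-Q  = All.map (λ {q} → algCone-least Z P (algCone-isCone G P′)
                              (λ a a∈⟨Z⟩ → ideal⊆algCone G P′ a (ideal-⊆-step groebner a a∈⟨Z⟩))
                              (Reduced⇒algCone red) q)
                            (Invariant.contains-Q inv)
    }

  LM-above-none : ∀ {Z L} t m → Irreducible Z t → IsLM ord t m →
                  All (DivisibleByLM Z) L → All (λ l → ¬ l ≤ᵥ m) L
  LM-above-none t m t-irr (tₘ≢0 , _) = All.map λ l-div l≤m →
    Irreducible⇒¬DivisibleByLM t t-irr tₘ≢0 (DivisibleByLM-∣ₘ l-div (≤ᵥ⇒∣ₘ l≤m))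

  saturate-acc : ∀ {Z P} (L : List (Mon n)) → Acc BadExtension L →
                 All (Irreducible Z) P → All (DivisibleByLM Z) L →
                 Acc (λ s′ s → Step ord s s′) (Z , P)
  saturate-acc {Z} L (acc smaller) P-irr L-div = acc λ where
    (step t ((t∈cone , _) , t≉0) groebner red) → case zero-or-LM t of λ where
      (inj₁ t≈0) → contradiction t≈0 t≉0
      (inj₂ (m , lm)) →
        saturate-acc (m ∷ L)
          (smaller (m , refl , LM-above-none t m (cone-least (Irreducible-isCone Z) P-irr t t∈cone) lm L-div))
          (Reduced⇒Irreducible red)
          (proj₂ groebner t (∈⇒ideal (here refl)) m lm ∷ All.map (DivisibleByLM-step groebner) L-div)

  invariant-reachable : ∀ {Q Z P} → Star (Step ord) (initState Q) (Z , P) → Invariant Q Z P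
  invariant-reachable {Q} run = Star-preserves (λ (Z , P) → Invariant Q Z P) invariant-step run (invariant-init Q)

  saturate-terminates : (Q : List (Poly n)) → Acc (λ s′ s → Step ord s s′) (initState Q)
  saturate-terminates Q = saturate-acc [] (dickson n []) (Invariant.irreducible (invariant-init Q)) []

  -- If p = a₁ + b₁ and -p = a₂ + b₂, then b₁ + b₂ ∈ ⟨Z⟩ is irreducible, hence 0,
  -- so b₁ is a unit of cone(P) and vanishes once the loop has stopped.
  units-algCone⊆ideal : ∀ {Z P} → IsGroebnerBasis ord (ideal Z) Z → All (Irreducible Z) P →
                        Final ord (Z , P) → units (algCone Z P) ⊆′ ideal Z
  units-algCone⊆ideal {Z} {P} groebner P-irr final p
    ((a₁ , b₁ , a₁∈⟨Z⟩ , b₁∈cone , p≈a₁+b₁) , (a₂ , b₂ , a₂∈⟨Z⟩ , b₂∈cone , -p≈a₂+b₂)) =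
    Ideal.∈-resp (ideal-isIdeal Z) a₁ p (λ m → sym (p≈a₁ m)) a₁∈⟨Z⟩
    where
    a+b≈0 : (a₁ +ₚ a₂) +ₚ (b₁ +ₚ b₂) ≈ 0ₚ
    a+b≈0 = begin
      (a₁ +ₚ a₂) +ₚ (b₁ +ₚ b₂)   ≈⟨ +ₚ-interchange a₁ a₂ b₁ b₂ ⟩
      (a₁ +ₚ b₁) +ₚ (a₂ +ₚ b₂)   ≈⟨ +ₚ-cong {p = a₁ +ₚ b₁} {p} {a₂ +ₚ b₂} { -ₚ p}
                                      (λ m → sym (p≈a₁+b₁ m)) (λ m → sym (-p≈a₂+b₂ m)) ⟩
      p +ₚ -ₚ p                  ≈⟨ +ₚ-inverseʳ p ⟩
      0ₚ                         ∎
      where open ≈-Reasoning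
    b₁+b₂≈0 : b₁ +ₚ b₂ ≈ 0ₚ
    b₁+b₂≈0 = groebner-irreducible⇒≈0 (b₁ +ₚ b₂) groebner
      (Ideal.∈-resp (ideal-isIdeal Z) (-ₚ (a₁ +ₚ a₂)) (b₁ +ₚ b₂)
        (λ m → sym (+ₚ≈0⇒≈-ₚ (a₁ +ₚ a₂) (b₁ +ₚ b₂) a+b≈0 m))
        (ideal--closed (ideal-isIdeal Z) (a₁ +ₚ a₂) (Ideal.+-closed (ideal-isIdeal Z) a₁ a₂ a₁∈⟨Z⟩ a₂∈⟨Z⟩)))
      (cone-least (Irreducible-isCone Z) P-irr (b₁ +ₚ b₂) (Cone.+-closed (cone-isCone P) b₁ b₂ b₁∈cone b₂∈cone))
    b₁≈0 : b₁ ≈ 0ₚ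
    b₁≈0 = ≈-stable {p = b₁} {0ₚ} λ b₁≉0 →
      final (b₁ , (b₁∈cone , Cone.∈-resp (cone-isCone P) b₂ (-ₚ b₁) (+ₚ≈0⇒≈-ₚ b₁ b₂ b₁+b₂≈0) b₂∈cone) , b₁≉0)
    p≈a₁ : p ≈ a₁
    p≈a₁ m = trans (p≈a₁+b₁ m) (trans (coeff-+ₚ a₁ b₁ m) (trans (cong (coeff a₁ m ℚ.+_) (b₁≈0 m)) (ℚP.+-identityʳ _)))

  ideal⊆units-algCone : ∀ {Z P} → ideal Z ⊆′ units {n} (algCone Z P)
  ideal⊆units-algCone {Z} {P} p p∈⟨Z⟩ =
    ideal⊆algCone Z P p p∈⟨Z⟩ , ideal⊆algCone Z P (-ₚ p) (ideal--closed (ideal-isIdeal Z) p p∈⟨Z⟩)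

  algCone-isRegularCone : ∀ {Q Z P} → Invariant Q Z P → Final ord (Z , P) → IsRegularCone (algCone Z P)
  algCone-isRegularCone {Z = Z} {P} inv final =
    algCone-isCone Z P , All.head contains-Q ,
    IsIdeal-resp-≐′ (ideal⊆units-algCone {Z} {P} , units-algCone⊆ideal groebner irreducible final) (ideal-isIdeal Z)
    where open Invariant inv

  Reduced-preserves : ∀ {C G P P′} → IsCone C → ideal G ⊆′ units C → Reduced ord G P P′ → All C P → All C P′
  Reduced-preserves isCone ⟨G⟩⊆units [] [] = []
  Reduced-preserves isCone ⟨G⟩⊆units (drop _ _ red) (_ ∷ P⊆C) = Reduced-preserves isCone ⟨G⟩⊆units red P⊆C
  Reduced-preserves isCone ⟨G⟩⊆units (keep {p} {r} (p-r∈⟨G⟩ , _) _ red) (p∈C ∷ P⊆C) =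
    Cone.∈-resp isCone (p +ₚ -ₚ (p -ₚ r)) r (p+[-[p-r]]≈r p r)
      (Cone.+-closed isCone p (-ₚ (p -ₚ r)) p∈C (proj₂ (⟨G⟩⊆units (p -ₚ r) p-r∈⟨G⟩)))
    ∷ Reduced-preserves isCone ⟨G⟩⊆units red P⊆C

  record Within (C : PSet n) (Z P : List (Poly n)) : Set where
    field
      Z⊆units : All (units C) Z
      P⊆C     : All C P

  within-step : ∀ {C} → IsRegularCone C → ∀ {Z P G P′} → Step ord (Z , P) (G , P′) → Within C Z P → Within C G P′
  within-step {C} (isCone , _ , units-isIdeal) {G = G} (step t ((t∈cone , -t∈cone) , _) groebner red) w = record
    { Z⊆units = G⊆units
    ; P⊆C     = Reduced-preserves isCone (ideal-least units-isIdeal G⊆units) red P⊆C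
    }
    where
    open Within w
    t-unit : units C t
    t-unit = cone-least isCone P⊆C t t∈cone , cone-least isCone P⊆C (-ₚ t) -t∈cone
    G⊆units : All (units C) G
    G⊆units = All.map (λ {g} → ideal-least units-isIdeal (t-unit ∷ Z⊆units) g) (proj₁ groebner)

  algCone⊆regular : ∀ {Q Z P} → Star (Step ord) (initState Q) (Z , P) →
                    ∀ C → IsRegularCone C → All C Q → algCone Z P ⊆′ C
  algCone⊆regular {Z = Z} {P} run C regular@(isCone , 1∈C , units-isIdeal) Q⊆C =
    algCone-least Z P isCone (λ p p∈⟨Z⟩ → proj₁ (ideal-least units-isIdeal Z⊆units p p∈⟨Z⟩)) P⊆C
    where
    within : Within C Z P
    within = Star-preserves (λ (Z , P) → Within C Z P) (within-step regular) run
               (record { Z⊆units = [] ; P⊆C = 1∈C ∷ Q⊆C })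
    open Within within

theorem3p5 : ∀ (n : ℕ) (ord : MonomialOrder n) (Q : List (Poly n)) →
    Acc (λ s' s → Step ord s s') (initState Q)
    × (∀ Z P → Star (Step ord) (initState Q) (Z , P) → Final ord (Z , P) →
         IsLeastRegularConeContaining (algCone Z P) Q)
theorem3p5 n ord Q = saturate-terminates ord Q , λ Z P run final →
  algCone-isRegularCone ord (invariant-reachable ord run) final ,
  All.tail (Invariant.contains-Q (invariant-reachable ord run)) ,
  algCone⊆regular ord run
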